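{- Let $w=w_1\cdots w_k$ be a word with letters in $[n]$. Then $\mathrm{rev}(\mathrm{rw}(\rho(w)))$ is Knuth-equivalent to $\mathrm{rev}(w)$.
   Context: $\mathrm{rev}$ reverses a word. Two words are Knuth-equivalent if one can be transformed into the other by a sequence of elementary Knuth transformations on consecutive triples of letters: $bac\leftrightarrow bca$ for $a<b\le c$, and $acb\leftrightarrow cab$ for $a\le b<c$. A tuple $B=(B_1,\dots,B_L)$ of subsets of $[n]$ is drawn with rows $1..L$ bottom to top and columns $1..n$ left to right (ball at $(r,j)$ iff $j\in B_r$). $\mathrm{rw}(B)$ records column numbers of balls scanning rows bottom to top, each row left to right; $\mathrm{cw}(B)$ records row numbers of balls scanning columns left to right, each column top to bottom. $\mathrm{Par}_i(w)$ writes "(" for each letter $i+1$ and ")" for each letter $i$ read left to right, matching iteratively when "(" is immediately followed by ")" or separated only by matched parentheses; a ball of row $i+1$ is unmatched above if its letter is unmatched in $\mathrm{Par}_i(\mathrm{cw}(B))$. $e_i^\star$ moves all balls of row $i+1$ unmatched above to row $i$ (same column). Operators compose right to left, $e^\star_{[a,b]}=e^\star_a\cdots e^\star_b$, and $\rho_N(B)=e^\star_{[1,L-1]}\cdots e^\star_{[1,1]}(B)$. Finally $\rho(w)=\rho_N((\{w_1\},\{w_2\},\dots,\{w_k\}))$. -}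

module Defs where

open import Data.Nat using (ℕ; zero; suc; _≤_; _<_; _≡ᵇ_; _∸_)
open import Data.Bool using (Bool; true; false; if_then_else_; _∧_; _∨_; not)
open import Data.List using (List; []; _∷_; _++_; map; concatMap; filterᵇ; applyUpTo; reverse; length; zip)
open import Data.Bool.ListAction using (any)
open import Data.Product using (_×_; _,_)
open import Relation.Binary.Construct.Closure.Equivalence using (EqClosure)
open import Function using (id; _∘_)

-- Words are lists of positive naturals (letters).
Word : Set
Word = List ℕ

data KnuthStep : Word → Word → Set where
  knuth₁ : ∀ (u v : Word) (a b c : ℕ) → a < b → b ≤ c →
           KnuthStep (u ++ b ∷ a ∷ c ∷ v) (u ++ b ∷ c ∷ a ∷ v)
  knuth₂ : ∀ (u v : Word) (a b c : ℕ) → a ≤ b → b < c →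
           KnuthStep (u ++ a ∷ c ∷ b ∷ v) (u ++ c ∷ a ∷ b ∷ v)

KnuthEquiv : Word → Word → Set
KnuthEquiv = EqClosure KnuthStep

-- A ball configuration B = (B_1,...,B_L): list of rows, bottom (row 1) first;
-- row r is a subset of columns, given by its characteristic function.
-- Columns range over [n] = {1,...,n}, n being passed explicitly to the
-- reading functions below.
Config : Set
Config = List (ℕ → Bool)

cols : ℕ → List ℕ
cols n = applyUpTo suc n

rowIdx : ℕ → List ℕ
rowIdx m = applyUpTo suc m

indexed : Config → List (ℕ × (ℕ → Bool))
indexed B = zip (rowIdx (length B)) B

rw : ℕ → Config → Word
rw n B = concatMap (λ row → filterᵇ row (cols n)) B

cwBalls : ℕ → Config → List (ℕ × ℕ)
cwBalls n B = concatMap colBalls (cols n)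
  where
  colBalls : ℕ → List (ℕ × ℕ)
  colBalls j = concatMap (λ { (r , row) → if row j then (r , j) ∷ [] else [] })
                         (reverse (indexed B))

cw : ℕ → Config → Word
cw n B = map (λ { (r , _) → r }) (cwBalls n B)

-- Bracket matching for Par_i: letter i+1 is "(", letter i is ")".
-- Scanning left to right with a stack of unmatched "(" (recorded by the
-- column of the corresponding ball); a ")" matches the nearest preceding
-- unmatched "(".  Returns the columns of the balls of row i+1 that are
-- unmatched.
unmatchedGo : ℕ → List ℕ → List (ℕ × ℕ) → List ℕ
unmatchedGo i st [] = st
unmatchedGo i st ((r , c) ∷ xs) =
  if r ≡ᵇ suc i then unmatchedGo i (c ∷ st) xs
  else if r ≡ᵇ i then pop st xs
  else unmatchedGo i st xs
  where
  pop : List ℕ → List (ℕ × ℕ) → List ℕ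
  pop [] ys = unmatchedGo i [] ys
  pop (_ ∷ s) ys = unmatchedGo i s ys

unmatchedAbove : ℕ → ℕ → Config → List ℕ
unmatchedAbove n i B = unmatchedGo i [] (cwBalls n B)

elemᵇ : ℕ → List ℕ → Bool
elemᵇ j xs = any (λ x → x ≡ᵇ j) xs

eStar : ℕ → ℕ → Config → Config
eStar n i B = map update (indexed B)
  where
  U : List ℕ
  U = unmatchedAbove n i B
  update : ℕ × (ℕ → Bool) → (ℕ → Bool)
  update (r , row) =
    if r ≡ᵇ suc i then (λ j → row j ∧ not (elemᵇ j U))
    else if r ≡ᵇ i then (λ j → row j ∨ elemᵇ j U)
    else row

eStarTo : ℕ → ℕ → Config → Config
eStarTo n zero = id
eStarTo n (suc b) = eStarTo n b ∘ eStar n (suc b)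

rhoSteps : ℕ → ℕ → Config → Config
rhoSteps n zero = id
rhoSteps n (suc m) = eStarTo n (suc m) ∘ rhoSteps n m

rhoN : ℕ → Config → Config
rhoN n B = rhoSteps n (length B ∸ 1) B

singletonRows : Word → Config
singletonRows w = map (λ a → λ j → j ≡ᵇ a) w

rho : ℕ → Word → Config
rho n w = rhoN n (singletonRows w)

{-# OPTIONS --safe #-}
module Submission where

-- reverse ∘ rw lists the rows from the top down, each as the strictly decreasing word
-- revRow of its columns, and e_i^⋆ only changes the words of rows i+1 and i.  So it
-- suffices to show that moving the unmatched columns U from the upper row Y to the
-- lower row X keeps revRow Y ++ revRow X in its Knuth class.  This goes by induction
-- on X, deleting its leftmost ball c.  Without c the unmatched set either stays the
-- same, and then c is simply appended to both sides, or it gains one column u ≤ c of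
-- Y; then the two sides differ by a column bump (hs u ls) c ≈ u (hs c ls), where
-- hs u ls is the word of the lower row for X without c, and a column bump is a chain
-- of elementary Knuth moves.

open import Defs
open import Data.Bool using (Bool; true; false; T; _∧_; _∨_; not; if_then_else_)
open import Data.Bool.Properties using (∧-identityʳ; T-≡)
open import Data.List
  using (List; []; _∷_; _++_; [_]; _∷ʳ_; reverse; filter; filterᵇ; applyUpTo; applyDownFrom;
         drop; take; foldl; zip; length; map; concatMap)
open import Data.List.Membership.Propositional using (_∈_; _∉_)
open import Data.List.Membership.Propositional.Properties
  using (∈-filter⁻; ∈-filter⁺; ∈-applyDownFrom⁻; ∈-applyDownFrom⁺; ∈-applyUpTo⁻;
         ∈-++⁻; ∈-++⁺ˡ; ∈-++⁺ʳ; ∈-∃++)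
open import Data.List.Properties
  using (++-assoc; ++-identityʳ; ∷ʳ-++; unfold-reverse; reverse-++; reverse-involutive; filter-++;
         reverse-applyUpTo; applyUpTo-∷ʳ; drop-[]; drop-drop; take++drop≡id; foldl-∷ʳ; foldl-++;
         concatMap-++; map-++; map-cong-local; length-map; length-zipWith; length-applyUpTo)
open import Data.List.Relation.Binary.Subset.Propositional using (_⊆_)
open import Data.List.Relation.Unary.All as All using (All; []; _∷_)
open import Data.List.Relation.Unary.All.Properties using () renaming (++⁻ to All-++⁻; ∷ʳ⁺ to All-∷ʳ⁺)
open import Data.List.Relation.Unary.AllPairs using (AllPairs; []; _∷_) renaming (head to AllPairs-head)
import Data.List.Relation.Unary.AllPairs.Properties as AllPairs
open import Data.List.Relation.Unary.Any as Any using (here; there)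
open import Data.List.Relation.Unary.Any.Properties using (any⁺; any⁻) renaming (reverse⁻ to Any-reverse⁻)
open import Data.Nat
  using (ℕ; zero; suc; _+_; _∸_; _⊓_; _≡ᵇ_; _≟_; _≤_; _<_; _>_; _≤′_; ≤′-refl; ≤′-step;
         z≤n; s≤s)
open import Data.Nat.Properties
  using (≡ᵇ⇒≡; ≡⇒≡ᵇ; ≤-refl; ≤-trans; <-trans; <⇒≤; <-irrefl; <-asym; <-≤-trans;
         ≤-<-trans; <-cmp; ≰⇒>; ≤-pred; m≤n⇒m<n∨m≡n; ≤′⇒≤; ≤⇒≤′; n<1+n; 1+n≢n;
         m≤m+n; m≤n+m; +-comm; +-suc; +-identityʳ; ⊓-idem)
open import Data.Product using (_×_; _,_; proj₁; proj₂; ∃-syntax)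
open import Data.Sum as Sum using (_⊎_; inj₁; inj₂)
open import Function using (_∘_)
open import Function.Bundles using (module Equivalence)
open import Relation.Binary.Bundles using (Setoid)
open import Relation.Binary.Construct.Closure.Equivalence using (setoid; gmap; return)
open import Relation.Binary.Definitions using (tri<; tri≈; tri>)
open import Relation.Binary.PropositionalEquality
  using (_≡_; _≢_; refl; sym; trans; cong; cong₂; subst; subst₂; module ≡-Reasoning)
import Relation.Binary.Reasoning.Setoid as SetoidReasoning
open import Relation.Nullary using (¬_; contradiction; does; yes; no)
open import Relation.Nullary.Decidable using (T?)
open import Relation.Unary using (Decidable)

-- Knuth equivalence

module ≈-Reasoning = SetoidReasoning (setoid KnuthStep)
open Setoid (setoid KnuthStep)
  using () renaming (refl to knuth-refl; trans to knuth-trans; reflexive to knuth-reflexive)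

knuthStep-++ˡ : ∀ p {u v} → KnuthStep u v → KnuthStep (p ++ u) (p ++ v)
knuthStep-++ˡ p (knuth₁ u v a b c a<b b≤c) =
  subst₂ KnuthStep (++-assoc p u _) (++-assoc p u _) (knuth₁ (p ++ u) v a b c a<b b≤c)
knuthStep-++ˡ p (knuth₂ u v a b c a≤b b<c) =
  subst₂ KnuthStep (++-assoc p u _) (++-assoc p u _) (knuth₂ (p ++ u) v a b c a≤b b<c)

knuthStep-++ʳ : ∀ q {u v} → KnuthStep u v → KnuthStep (u ++ q) (v ++ q)
knuthStep-++ʳ q (knuth₁ u v a b c a<b b≤c) =
  subst₂ KnuthStep (sym (++-assoc u _ q)) (sym (++-assoc u _ q)) (knuth₁ u (v ++ q) a b c a<b b≤c)
knuthStep-++ʳ q (knuth₂ u v a b c a≤b b<c) =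
  subst₂ KnuthStep (sym (++-assoc u _ q)) (sym (++-assoc u _ q)) (knuth₂ u (v ++ q) a b c a≤b b<c)

knuth-++ˡ : ∀ p {u v} → KnuthEquiv u v → KnuthEquiv (p ++ u) (p ++ v)
knuth-++ˡ p = gmap (p ++_) (knuthStep-++ˡ p)

knuth-++ʳ : ∀ q {u v} → KnuthEquiv u v → KnuthEquiv (u ++ q) (v ++ q)
knuth-++ʳ q = gmap (_++ q) (knuthStep-++ʳ q)

AllPairs-++⁻ : ∀ {A : Set} {R : A → A → Set} xs {ys} → AllPairs R (xs ++ ys) →
               AllPairs R xs × AllPairs R ys × All (λ x → All (R x) ys) xs
AllPairs-++⁻ []       Rys           = [] , Rys , []
AllPairs-++⁻ (x ∷ xs) (Rx ∷ Rxsys) =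
  let Rxs , Rys , Rxsys′ = AllPairs-++⁻ xs Rxsys
      Rxxs , Rxys = All-++⁻ xs Rx
  in Rxxs ∷ Rxs , Rys , Rxys ∷ Rxsys′

All-reverse⁺ : ∀ {A : Set} {P : A → Set} {xs} → All P xs → All P (reverse xs)
All-reverse⁺ pxs = All.tabulate (All.lookup pxs ∘ Any-reverse⁻)

module _ {A : Set} {P : A → Set} (P? : Decidable P) where

  filter-reverse : ∀ xs → filter P? (reverse xs) ≡ reverse (filter P? xs)
  filter-reverse []       = refl
  filter-reverse (x ∷ xs) = begin
    filter P? (reverse (x ∷ xs))                        ≡⟨ cong (filter P?) (unfold-reverse x xs) ⟩
    filter P? (reverse xs ∷ʳ x)                         ≡⟨ filter-++ P? (reverse xs) [ x ] ⟩
    filter P? (reverse xs) ++ filter P? [ x ]           ≡⟨ cong₂ _++_ (filter-reverse xs) (sym reverse-filter-[x]) ⟩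
    reverse (filter P? xs) ++ reverse (filter P? [ x ]) ≡⟨ reverse-++ (filter P? [ x ]) (filter P? xs) ⟨
    reverse (filter P? [ x ] ++ filter P? xs)           ≡⟨ cong reverse (filter-++ P? [ x ] xs) ⟨
    reverse (filter P? (x ∷ xs))                        ∎
    where
    open ≡-Reasoning
    reverse-filter-[x] : reverse (filter P? [ x ]) ≡ filter P? [ x ]
    reverse-filter-[x] with does (P? x)
    ... | true  = refl
    ... | false = refl

reverse-++-∷-∷ : ∀ {A : Set} (P : List A) {a b} Q → reverse (P ++ a ∷ b ∷ Q) ≡ reverse Q ++ b ∷ a ∷ reverse P
reverse-++-∷-∷ P {a} {b} Q = trans (reverse-++ P (a ∷ b ∷ Q))
  (trans (cong (_++ reverse P) (reverse-++ (a ∷ b ∷ []) Q)) (++-assoc (reverse Q) (b ∷ a ∷ []) (reverse P)))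

foldl-concatMap : ∀ {A B C : Set} (f : B → A → B) (g : C → List A) {h : B → C → B} →
                  (∀ st x → foldl f st (g x) ≡ h st x) → ∀ st xs → foldl f st (concatMap g xs) ≡ foldl h st xs
foldl-concatMap f g fg≡h st []       = refl
foldl-concatMap f g fg≡h st (x ∷ xs) =
  trans (foldl-++ f st (g x) (concatMap g xs))
        (trans (cong (λ st′ → foldl f st′ (concatMap g xs)) (fg≡h st x)) (foldl-concatMap f g fg≡h _ xs))

-- Strictly decreasing words

Decreasing : Word → Set
Decreasing = AllPairs _>_

decreasing-unique : ∀ {xs ys} → Decreasing xs → Decreasing ys → xs ⊆ ys → ys ⊆ xs → xs ≡ ys
decreasing-unique []          []          _     _     = refl
decreasing-unique []          (_ ∷ _)     _     ys⊆xs with () ← ys⊆xs (here refl)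
decreasing-unique (_ ∷ _)     []          xs⊆ys _     with () ← xs⊆ys (here refl)
decreasing-unique {x ∷ _} (x>xs ∷ xs↓) (y>ys ∷ ys↓) xs⊆ys ys⊆xs
  with xs⊆ys (here refl) | ys⊆xs (here refl)
... | here refl  | _          =
  cong (x ∷_) (decreasing-unique xs↓ ys↓ (⊆-tail x>xs xs⊆ys) (⊆-tail y>ys ys⊆xs))
  where
  ⊆-tail : ∀ {as bs} → All (_< x) as → (x ∷ as) ⊆ (x ∷ bs) → as ⊆ bs
  ⊆-tail x>as sub j∈as with sub (there j∈as)
  ... | here refl  = contradiction (All.lookup x>as j∈as) (<-irrefl refl)
  ... | there j∈bs = j∈bs
... | there x∈ys | here refl  = contradiction (All.lookup y>ys x∈ys) (<-irrefl refl)
... | there x∈ys | there y∈xs = contradiction (All.lookup x>xs y∈xs) (<-asym (All.lookup y>ys x∈ys))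

∈-below-pivot : ∀ hs {u rest j} → Decreasing (hs ++ u ∷ rest) → j ∈ hs ++ u ∷ rest → j < u → j ∈ rest
∈-below-pivot hs ↓ j∈ j<u with _ , _ , hs>u∷rest ← AllPairs-++⁻ hs ↓ with ∈-++⁻ hs j∈
... | inj₁ j∈hs         = contradiction j<u (<-asym (All.head (All.lookup hs>u∷rest j∈hs)))
... | inj₂ (here refl)  = contradiction j<u (<-irrefl refl)
... | inj₂ (there j∈rest) = j∈rest

slide-under-head : ∀ d ls {x} → Decreasing (d ∷ ls) → d ≤ x → KnuthEquiv ((d ∷ ls) ∷ʳ x) (d ∷ x ∷ ls)
slide-under-head d []       _                    _   = knuth-refl
slide-under-head d (l ∷ ls) ((l<d ∷ _) ∷ l∷ls↓) d≤x =
  knuth-trans (knuth-++ˡ [ d ] (slide-under-head l ls l∷ls↓ (<⇒≤ (<-≤-trans l<d d≤x))))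
              (return (knuth₁ [] ls l d _ l<d d≤x))

slide-to-front : ∀ hs {s z rest} → Decreasing hs → s ≤ z → All (z <_) hs →
                 KnuthEquiv (s ∷ hs ++ z ∷ rest) (hs ++ s ∷ z ∷ rest)
slide-to-front []            _                   _   _                = knuth-refl
slide-to-front (h ∷ [])      _                   s≤z (z<h ∷ [])       = return (knuth₂ [] _ _ _ h s≤z z<h)
slide-to-front (h ∷ h′ ∷ hs) ((h′<h ∷ _) ∷ hs↓) s≤z (_ ∷ z<h′ ∷ z<hs) =
  knuth-trans (return (knuth₂ [] _ _ h′ h (≤-trans s≤z (<⇒≤ z<h′)) h′<h))
              (knuth-++ˡ [ h ] (slide-to-front (h′ ∷ hs) hs↓ s≤z (z<h′ ∷ z<hs)))

column-bump : ∀ hs {u ls x} → Decreasing (hs ++ u ∷ ls) → u ≤ x → All (x <_) hs →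
              KnuthEquiv (u ∷ hs ++ x ∷ ls) ((hs ++ u ∷ ls) ∷ʳ x)
column-bump hs {u} {ls} {x} ↓ u≤x x<hs with hs↓ , u∷ls↓ , _ ← AllPairs-++⁻ hs ↓ = begin
  u ∷ hs ++ x ∷ ls        ≈⟨ slide-to-front hs hs↓ u≤x x<hs ⟩
  hs ++ u ∷ x ∷ ls        ≈⟨ knuth-++ˡ hs (slide-under-head u ls u∷ls↓ u≤x) ⟨
  hs ++ (u ∷ ls) ∷ʳ x     ≡⟨ ++-assoc hs (u ∷ ls) [ x ] ⟨
  (hs ++ u ∷ ls) ∷ʳ x     ∎
  where open ≈-Reasoning

IsColumn : ℕ → ℕ → Set
IsColumn n j = 1 ≤ j × j ≤ n

revRow : ℕ → (ℕ → Bool) → Word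
revRow n P = filterᵇ P (applyDownFrom suc n)

reverse-rowWord : ∀ n P → reverse (filterᵇ P (cols n)) ≡ revRow n P
reverse-rowWord n P =
  trans (sym (filter-reverse (T? ∘ P) (cols n))) (cong (filterᵇ P) (reverse-applyUpTo suc n))

revRow-decreasing : ∀ n P → Decreasing (revRow n P)
revRow-decreasing n P =
  AllPairs.filter⁺ (T? ∘ P) (AllPairs.applyDownFrom⁺₁ suc n (λ j<i _ → s≤s j<i))

∈-revRow⁻ : ∀ {n P j} → j ∈ revRow n P → IsColumn n j × T (P j)
∈-revRow⁻ {n} {P} j∈ with j∈down , Pj ← ∈-filter⁻ (T? ∘ P) {xs = applyDownFrom suc n} j∈
                      with i , i<n , refl ← ∈-applyDownFrom⁻ suc j∈down = (s≤s z≤n , i<n) , Pj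

∈-revRow⁺ : ∀ {n P j} → IsColumn n j → T (P j) → j ∈ revRow n P
∈-revRow⁺ {P = P} (s≤s z≤n , i<n) Pj = ∈-filter⁺ (T? ∘ P) (∈-applyDownFrom⁺ suc i<n) Pj

revRow-≡ : ∀ {n P xs} → Decreasing xs →
           (∀ {j} → j ∈ xs → IsColumn n j × T (P j)) →
           (∀ {j} → IsColumn n j → T (P j) → j ∈ xs) →
           revRow n P ≡ xs
revRow-≡ {n} {P} xs↓ sound complete =
  decreasing-unique (revRow-decreasing n P) xs↓
    (λ j∈ → let col , Pj = ∈-revRow⁻ j∈ in complete col Pj)
    (λ j∈ → let col , Pj = sound j∈ in ∈-revRow⁺ col Pj)

revRow-∷ʳ : ∀ {n P Q c} → IsColumn n c → T (P c) →
            (∀ {j} → IsColumn n j → T (Q j) → T (P j) × c < j) →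
            (∀ {j} → IsColumn n j → T (P j) → j ≡ c ⊎ T (Q j)) →
            revRow n P ≡ revRow n Q ∷ʳ c
revRow-∷ʳ {n} {P} {Q} {c} c-col Pc Q⇒P P⇒Q = revRow-≡ decreasing sound complete
  where
  decreasing : Decreasing (revRow n Q ∷ʳ c)
  decreasing = AllPairs.++⁺ (revRow-decreasing n Q) ([] ∷ [])
    (All.tabulate (λ j∈ → let col , Qj = ∈-revRow⁻ j∈ in proj₂ (Q⇒P col Qj) ∷ []))
  sound : ∀ {j} → j ∈ revRow n Q ∷ʳ c → IsColumn n j × T (P j)
  sound j∈ with ∈-++⁻ (revRow n Q) j∈
  ... | inj₁ j∈Q       = let col , Qj = ∈-revRow⁻ j∈Q in col , proj₁ (Q⇒P col Qj)
  ... | inj₂ (here refl) = c-col , Pc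
  complete : ∀ {j} → IsColumn n j → T (P j) → j ∈ revRow n Q ∷ʳ c
  complete col Pj with P⇒Q col Pj
  ... | inj₁ refl = ∈-++⁺ʳ (revRow n Q) (here refl)
  ... | inj₂ Qj   = ∈-++⁺ˡ (∈-revRow⁺ col Qj)

revRow-replace : ∀ {n P Q u c} hs ls → revRow n Q ≡ hs ++ u ∷ ls → u ≤ c → All (c <_) hs →
                 IsColumn n c → T (P c) →
                 (∀ {j} → IsColumn n j → T (Q j) → j ≢ u → T (P j)) →
                 (∀ {j} → IsColumn n j → T (P j) → j ≡ c ⊎ T (Q j) × j ≢ u) →
                 revRow n P ≡ hs ++ c ∷ ls
revRow-replace {n} {P} {Q} {u} {c} hs ls Q≡ u≤c c<hs c-col Pc Q⇒P P⇒Q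
  with hs↓ , u>ls ∷ ls↓ , hs>u∷ls ← AllPairs-++⁻ hs (subst Decreasing Q≡ (revRow-decreasing n Q)) =
  revRow-≡ decreasing sound complete
  where
  decreasing : Decreasing (hs ++ c ∷ ls)
  decreasing = AllPairs.++⁺ hs↓ (All.map (λ l<u → <-≤-trans l<u u≤c) u>ls ∷ ls↓)
    (All.zipWith (λ (c<h , h>u∷ls) → c<h ∷ All.tail h>u∷ls) (c<hs , hs>u∷ls))
  inQ : ∀ {j} → j ∈ hs ++ u ∷ ls → j ≢ u → IsColumn n j × T (P j)
  inQ j∈ j≢u = let col , Qj = ∈-revRow⁻ (subst (_ ∈_) (sym Q≡) j∈) in col , Q⇒P col Qj j≢u
  sound : ∀ {j} → j ∈ hs ++ c ∷ ls → IsColumn n j × T (P j)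
  sound j∈ with ∈-++⁻ hs j∈
  ... | inj₁ j∈hs         =
    inQ (∈-++⁺ˡ j∈hs) (λ { refl → <-irrefl refl (All.head (All.lookup hs>u∷ls j∈hs)) })
  ... | inj₂ (here refl)  = c-col , Pc
  ... | inj₂ (there j∈ls) =
    inQ (∈-++⁺ʳ hs (there j∈ls)) (λ { refl → <-irrefl refl (All.lookup u>ls j∈ls) })
  complete : ∀ {j} → IsColumn n j → T (P j) → j ∈ hs ++ c ∷ ls
  complete col Pj with P⇒Q col Pj
  ... | inj₁ refl        = ∈-++⁺ʳ hs (here refl)
  ... | inj₂ (Qj , j≢u) with ∈-++⁻ hs (subst (_ ∈_) Q≡ (∈-revRow⁺ col Qj))
  ...   | inj₁ j∈hs         = ∈-++⁺ˡ j∈hs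
  ...   | inj₂ (here refl)  = contradiction refl j≢u
  ...   | inj₂ (there j∈ls) = ∈-++⁺ʳ hs (there j∈ls)

T-elemᵇ⁺ : ∀ {j U} → j ∈ U → T (elemᵇ j U)
T-elemᵇ⁺ {j} j∈U = any⁺ (_≡ᵇ j) (Any.map (λ { refl → ≡⇒≡ᵇ j j refl }) j∈U)

T-elemᵇ⁻ : ∀ {j} U → T (elemᵇ j U) → j ∈ U
T-elemᵇ⁻ {j} U h = Any.map (λ {x} x≡ᵇj → sym (≡ᵇ⇒≡ x j x≡ᵇj)) (any⁻ (_≡ᵇ j) U h)

_∖_ : (ℕ → Bool) → List ℕ → ℕ → Bool
(P ∖ U) j = P j ∧ not (elemᵇ j U)

_∪_ : (ℕ → Bool) → List ℕ → ℕ → Bool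
(P ∪ U) j = P j ∨ elemᵇ j U

∖⁺ : ∀ P U {j} → T (P j) → j ∉ U → T ((P ∖ U) j)
∖⁺ P U {j} Pj j∉U with P j | elemᵇ j U in e
... | true | true  = j∉U (T-elemᵇ⁻ U (subst T (sym e) _))
... | true | false = _

∖⁻ : ∀ P U {j} → T ((P ∖ U) j) → T (P j) × j ∉ U
∖⁻ P U {j} h with P j | elemᵇ j U in e
... | true | false = _ , λ j∈U → subst T e (T-elemᵇ⁺ j∈U)

∖-∉ : ∀ P U {j} → j ∉ U → (P ∖ U) j ≡ P j
∖-∉ P U {j} j∉U with elemᵇ j U in e
... | true  = contradiction (T-elemᵇ⁻ U (subst T (sym e) _)) j∉U
... | false = ∧-identityʳ (P j)

∪⁺ˡ : ∀ P U {j} → T (P j) → T ((P ∪ U) j)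
∪⁺ˡ P U {j} Pj with P j
... | true = _

∪⁺ʳ : ∀ P U {j} → j ∈ U → T ((P ∪ U) j)
∪⁺ʳ P U {j} j∈U with P j
... | true  = _
... | false = T-elemᵇ⁺ j∈U

∪⁻ : ∀ P U {j} → T ((P ∪ U) j) → T (P j) ⊎ j ∈ U
∪⁻ P U {j} h with P j
... | true  = inj₁ _
... | false = inj₂ (T-elemᵇ⁻ U h)

-- Bracket matching of two rows

-- Par_i column by column: in column j the ball of the upper row Y is read first, as
-- an opening bracket, then the ball of the lower row X, as a closing one.  The stack
-- holds the columns of the still unmatched opening brackets.
pushIf : Bool → ℕ → List ℕ → List ℕ
pushIf b j st = if b then j ∷ st else st

popIf : Bool → List ℕ → List ℕ
popIf b st = if b then drop 1 st else st

matchColumn : (X Y : ℕ → Bool) → List ℕ → ℕ → List ℕ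
matchColumn X Y st j = popIf (X j) (pushIf (Y j) j st)

unmatched : (X Y : ℕ → Bool) → List ℕ → List ℕ → List ℕ
unmatched X Y = foldl (matchColumn X Y)

surplusStep : Bool → Bool → ℕ → ℕ
surplusStep true  false e = e ∸ 1
surplusStep false true  e = suc e
surplusStep _     _     e = e

-- The number of pops in js that reach below the initial stack.
surplusPops : (X Y : ℕ → Bool) → List ℕ → ℕ
surplusPops X Y []       = 0
surplusPops X Y (j ∷ js) = surplusStep (Y j) (X j) (surplusPops X Y js)

drop-popIf-pushIf : ∀ y x j e st →
  drop e (popIf x (pushIf y j st)) ≡ drop e (popIf x (pushIf y j [])) ++ drop (surplusStep y x e) st
drop-popIf-pushIf true  true  j e       st = cong (_++ drop e st) (sym (drop-[] e))
drop-popIf-pushIf true  false j zero    st = refl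
drop-popIf-pushIf true  false j (suc e) st = cong (_++ drop e st) (sym (drop-[] e))
drop-popIf-pushIf false true  j e       st = trans (drop-drop 1 e st) (cong (_++ drop (suc e) st) (sym (drop-[] e)))
drop-popIf-pushIf false false j e       st = cong (_++ drop e st) (sym (drop-[] e))

unmatched-from-stack : ∀ X Y st js →
  unmatched X Y st js ≡ unmatched X Y [] js ++ drop (surplusPops X Y js) st
unmatched-from-stack X Y st []       = refl
unmatched-from-stack X Y st (j ∷ js) = begin
  unmatched X Y (matchColumn X Y st j) js
    ≡⟨ unmatched-from-stack X Y _ js ⟩
  unmatched X Y [] js ++ drop e (matchColumn X Y st j)
    ≡⟨ cong (unmatched X Y [] js ++_) (drop-popIf-pushIf (Y j) (X j) j e st) ⟩
  unmatched X Y [] js ++ drop e (matchColumn X Y [] j) ++ rest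
    ≡⟨ ++-assoc (unmatched X Y [] js) _ rest ⟨
  (unmatched X Y [] js ++ drop e (matchColumn X Y [] j)) ++ rest
    ≡⟨ cong (_++ rest) (unmatched-from-stack X Y _ js) ⟨
  unmatched X Y (matchColumn X Y [] j) js ++ rest ∎
  where
  open ≡-Reasoning
  e : ℕ
  e = surplusPops X Y js
  rest : List ℕ
  rest = drop (surplusPops X Y (j ∷ js)) st

unmatched-cong : ∀ {X X′} Y st {js} → All (λ j → X j ≡ X′ j) js →
                 unmatched X Y st js ≡ unmatched X′ Y st js
unmatched-cong Y st []                       = refl
unmatched-cong {X} Y st {j ∷ js} (Xj≡X′j ∷ agree) =
  trans (cong (λ b → unmatched X Y (popIf b (pushIf (Y j) j st)) js) Xj≡X′j) (unmatched-cong Y _ agree)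

∈-matchColumn⁻ : ∀ X Y st k {j} → j ∈ matchColumn X Y st k → j ≡ k ⊎ j ∈ st
∈-matchColumn⁻ X Y st       k j∈ with X k | Y k
∈-matchColumn⁻ X Y st       k j∈          | false | false = inj₂ j∈
∈-matchColumn⁻ X Y st       k (here refl) | false | true  = inj₁ refl
∈-matchColumn⁻ X Y st       k (there j∈)  | false | true  = inj₂ j∈
∈-matchColumn⁻ X Y st       k j∈          | true  | true  = inj₂ j∈
∈-matchColumn⁻ X Y (_ ∷ st) k j∈          | true  | false = inj₂ (there j∈)

∈-unmatched⁻ : ∀ X Y st js {j} → j ∈ unmatched X Y st js → j ∈ st ⊎ j ∈ js
∈-unmatched⁻ X Y st []       j∈ = inj₁ j∈
∈-unmatched⁻ X Y st (k ∷ js) j∈ with ∈-unmatched⁻ X Y _ js j∈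
... | inj₂ j∈js = inj₂ (there j∈js)
... | inj₁ j∈st′ with ∈-matchColumn⁻ X Y st k j∈st′
...   | inj₁ refl = inj₂ (here refl)
...   | inj₂ j∈st = inj₁ j∈st

unmatched-without-pops : ∀ X Y st {js} → All (λ j → ¬ T (X j)) js →
                         unmatched X Y st js ≡ reverse (filterᵇ Y js) ++ st
unmatched-without-pops X Y st []                   = refl
unmatched-without-pops X Y st {j ∷ js} (¬Xj ∷ ¬Xjs) with X j
... | true  = contradiction _ ¬Xj
... | false with Y j
...   | false = unmatched-without-pops X Y st ¬Xjs
...   | true  = begin
  unmatched X Y (j ∷ st) js         ≡⟨ unmatched-without-pops X Y _ ¬Xjs ⟩
  reverse (filterᵇ Y js) ++ j ∷ st   ≡⟨ ∷ʳ-++ (reverse (filterᵇ Y js)) j st ⟨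
  reverse (filterᵇ Y js) ∷ʳ j ++ st  ≡⟨ cong (_++ st) (unfold-reverse j (filterᵇ Y js)) ⟨
  reverse (j ∷ filterᵇ Y js) ++ st   ∎
  where open ≡-Reasoning

NoneBelow : ℕ → (ℕ → Bool) → Set
NoneBelow c X = ∀ {j} → 1 ≤ j → j < c → ¬ T (X j)

noneBelow-suc : ∀ {c X} → NoneBelow c X → ¬ T (X c) → NoneBelow (suc c) X
noneBelow-suc none ¬Xc 1≤j j<1+c with m≤n⇒m<n∨m≡n (≤-pred j<1+c)
... | inj₁ j<c  = none 1≤j j<c
... | inj₂ refl = ¬Xc

cols-∷ʳ : ∀ b → cols (suc b) ≡ cols b ∷ʳ suc b
cols-∷ʳ b = sym (applyUpTo-∷ʳ suc b)

cols-split : ∀ {c n} → c ≤′ n → ∃[ post ] cols n ≡ cols c ++ post × All (c <_) post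
cols-split         ≤′-refl         = [] , sym (++-identityʳ _) , []
cols-split {c} (≤′-step {n} c≤′n) with post , cols-n , c<post ← cols-split c≤′n =
  post ∷ʳ suc n , cols-suc-n , All-∷ʳ⁺ c<post (s≤s (≤′⇒≤ c≤′n))
  where
  cols-suc-n : cols (suc n) ≡ cols c ++ post ∷ʳ suc n
  cols-suc-n = trans (cols-∷ʳ n) (trans (cong (_∷ʳ suc n) cols-n) (++-assoc (cols c) post [ suc n ]))

unmatched-noneBelow : ∀ b {X} Y → NoneBelow (suc b) X → unmatched X Y [] (cols b) ≡ revRow b Y
unmatched-noneBelow b {X} Y none =
  trans (unmatched-without-pops X Y [] (All.tabulate none-cols))
        (trans (++-identityʳ _) (reverse-rowWord b Y))
  where
  none-cols : ∀ {j} → j ∈ cols b → ¬ T (X j)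
  none-cols j∈ with i , i<b , refl ← ∈-applyUpTo⁻ suc j∈ = none (s≤s z≤n) (s≤s i<b)

unmatched-first-pop : ∀ b {X} Y → NoneBelow (suc b) X →
                      unmatched X Y [] (cols (suc b)) ≡ popIf (X (suc b)) (revRow (suc b) Y)
unmatched-first-pop b {X} Y none = begin
  unmatched X Y [] (cols (suc b))
    ≡⟨ cong (unmatched X Y []) (cols-∷ʳ b) ⟩
  unmatched X Y [] (cols b ∷ʳ suc b)
    ≡⟨ foldl-∷ʳ (matchColumn X Y) [] (suc b) (cols b) ⟩
  matchColumn X Y (unmatched X Y [] (cols b)) (suc b)
    ≡⟨ cong (λ st → matchColumn X Y st (suc b)) (unmatched-noneBelow b Y none) ⟩
  popIf (X (suc b)) (pushIf (Y (suc b)) (suc b) (revRow b Y))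
    ≡⟨ cong (popIf (X (suc b))) push-revRow ⟩
  popIf (X (suc b)) (revRow (suc b) Y) ∎
  where
  open ≡-Reasoning
  push-revRow : pushIf (Y (suc b)) (suc b) (revRow b Y) ≡ revRow (suc b) Y
  push-revRow with Y (suc b)
  ... | true  = refl
  ... | false = refl

-- Moving the unmatched balls of two rows

MoveInvariant : ℕ → (Y X : ℕ → Bool) → List ℕ → Set
MoveInvariant n Y X V = KnuthEquiv (revRow n (Y ∖ V) ++ revRow n (X ∪ V)) (revRow n Y ++ revRow n X)

module LeftmostBall {n : ℕ} (Y X : ℕ → Bool) {c : ℕ}
                    (c-col : IsColumn n c) (Xc : T (X c)) (none : NoneBelow c X) where

  X₀ : ℕ → Bool
  X₀ = X ∖ [ c ]

  X₀⇒X : ∀ {j} → T (X₀ j) → T (X j) × j ≢ c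
  X₀⇒X X₀j = let Xj , j∉[c] = ∖⁻ X [ c ] X₀j in Xj , λ j≡c → j∉[c] (here j≡c)

  X⇒X₀ : ∀ {j} → T (X j) → j ≡ c ⊎ T (X₀ j)
  X⇒X₀ {j} Xj with j ≟ c
  ... | yes j≡c = inj₁ j≡c
  ... | no  j≢c = inj₂ (∖⁺ X [ c ] Xj λ { (here j≡c) → j≢c j≡c })

  c<X₀ : ∀ {j} → IsColumn n j → T (X₀ j) → c < j
  c<X₀ {j} (1≤j , _) X₀j with Xj , j≢c ← X₀⇒X X₀j with <-cmp j c
  ... | tri< j<c _ _ = contradiction Xj (none 1≤j j<c)
  ... | tri≈ _ j≡c _ = contradiction j≡c j≢c
  ... | tri> _ _ c<j = c<j

  revRow-X : revRow n X ≡ revRow n X₀ ∷ʳ c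
  revRow-X = revRow-∷ʳ c-col Xc (λ col X₀j → proj₁ (X₀⇒X X₀j) , c<X₀ col X₀j) (λ _ → X⇒X₀)

  append-c : ∀ {w} → KnuthEquiv w (revRow n Y ++ revRow n X₀) →
             KnuthEquiv (w ∷ʳ c) (revRow n Y ++ revRow n X)
  append-c {w} w≈ = begin
    w ∷ʳ c                               ≈⟨ knuth-++ʳ [ c ] w≈ ⟩
    (revRow n Y ++ revRow n X₀) ∷ʳ c     ≡⟨ ++-assoc (revRow n Y) (revRow n X₀) [ c ] ⟩
    revRow n Y ++ revRow n X₀ ∷ʳ c       ≡⟨ cong (revRow n Y ++_) revRow-X ⟨
    revRow n Y ++ revRow n X             ∎
    where open ≈-Reasoning

  invariant-unchanged : ∀ {V} → (∀ {j} → j ∈ V → c < j) → MoveInvariant n Y X₀ V → MoveInvariant n Y X V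
  invariant-unchanged {V} c<V ih = begin
    revRow n (Y ∖ V) ++ revRow n (X ∪ V)          ≡⟨ cong (revRow n (Y ∖ V) ++_) revRow-X∪V ⟩
    revRow n (Y ∖ V) ++ revRow n (X₀ ∪ V) ∷ʳ c    ≡⟨ ++-assoc (revRow n (Y ∖ V)) _ [ c ] ⟨
    (revRow n (Y ∖ V) ++ revRow n (X₀ ∪ V)) ∷ʳ c  ≈⟨ append-c ih ⟩
    revRow n Y ++ revRow n X                      ∎
    where
    open ≈-Reasoning
    revRow-X∪V : revRow n (X ∪ V) ≡ revRow n (X₀ ∪ V) ∷ʳ c
    revRow-X∪V = revRow-∷ʳ c-col (∪⁺ˡ X V Xc) X₀∪V⇒X∪V X∪V⇒X₀∪V
      where
      X₀∪V⇒X∪V : ∀ {j} → IsColumn n j → T ((X₀ ∪ V) j) → T ((X ∪ V) j) × c < j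
      X₀∪V⇒X∪V col h with ∪⁻ X₀ V h
      ... | inj₁ X₀j = ∪⁺ˡ X V (proj₁ (X₀⇒X X₀j)) , c<X₀ col X₀j
      ... | inj₂ j∈V = ∪⁺ʳ X V j∈V , c<V j∈V
      X∪V⇒X₀∪V : ∀ {j} → IsColumn n j → T ((X ∪ V) j) → j ≡ c ⊎ T ((X₀ ∪ V) j)
      X∪V⇒X₀∪V col h with ∪⁻ X V h
      ... | inj₁ Xj  = Sum.map₂ (∪⁺ˡ X₀ V) (X⇒X₀ Xj)
      ... | inj₂ j∈V = inj₂ (∪⁺ʳ X₀ V j∈V)

  module Bumped (R rest : List ℕ) {u : ℕ} (c<R : ∀ {j} → j ∈ R → c < j) (u-col : IsColumn c u) (Yu : T (Y u))
                (u>rest : All (_< u) rest) (Y-below-u : ∀ {j} → 1 ≤ j → j < u → T (Y j) → j ∈ rest) where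

    V V₀ : List ℕ
    V  = R ++ rest
    V₀ = R ++ u ∷ rest

    u≤c : u ≤ c
    u≤c = proj₂ u-col

    u-colₙ : IsColumn n u
    u-colₙ = proj₁ u-col , ≤-trans u≤c (proj₂ c-col)

    V⊆V₀ : V ⊆ V₀
    V⊆V₀ j∈V with ∈-++⁻ R j∈V
    ... | inj₁ j∈R    = ∈-++⁺ˡ j∈R
    ... | inj₂ j∈rest = ∈-++⁺ʳ R (there j∈rest)

    V₀⊆u∷V : ∀ {j} → j ∈ V₀ → j ≡ u ⊎ j ∈ V
    V₀⊆u∷V j∈V₀ with ∈-++⁻ R j∈V₀
    ... | inj₁ j∈R            = inj₂ (∈-++⁺ˡ j∈R)
    ... | inj₂ (here j≡u)     = inj₁ j≡u
    ... | inj₂ (there j∈rest) = inj₂ (∈-++⁺ʳ R j∈rest)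

    u∉V : u ∉ V
    u∉V u∈V with ∈-++⁻ R u∈V
    ... | inj₁ u∈R    = <-irrefl refl (≤-<-trans u≤c (c<R u∈R))
    ... | inj₂ u∈rest = <-irrefl refl (All.lookup u>rest u∈rest)

    revRow-Y∖V : revRow n (Y ∖ V) ≡ revRow n (Y ∖ V₀) ∷ʳ u
    revRow-Y∖V = revRow-∷ʳ u-colₙ (∖⁺ Y V Yu u∉V) Y∖V₀⇒Y∖V Y∖V⇒Y∖V₀
      where
      Y∖V₀⇒Y∖V : ∀ {j} → IsColumn n j → T ((Y ∖ V₀) j) → T ((Y ∖ V) j) × u < j
      Y∖V₀⇒Y∖V {j} (1≤j , _) h with Yj , j∉V₀ ← ∖⁻ Y V₀ h =
        ∖⁺ Y V Yj (j∉V₀ ∘ V⊆V₀) , ≰⇒> j≰u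
        where
        j≰u : ¬ j ≤ u
        j≰u j≤u with m≤n⇒m<n∨m≡n j≤u
        ... | inj₁ j<u  = j∉V₀ (∈-++⁺ʳ R (there (Y-below-u 1≤j j<u Yj)))
        ... | inj₂ refl = j∉V₀ (∈-++⁺ʳ R (here refl))
      Y∖V⇒Y∖V₀ : ∀ {j} → IsColumn n j → T ((Y ∖ V) j) → j ≡ u ⊎ T ((Y ∖ V₀) j)
      Y∖V⇒Y∖V₀ {j} _ h with Yj , j∉V ← ∖⁻ Y V h with j ≟ u
      ... | yes j≡u = inj₁ j≡u
      ... | no  j≢u = inj₂ (∖⁺ Y V₀ Yj (Sum.[ j≢u , j∉V ] ∘ V₀⊆u∷V))

    u∈X₀∪V₀ : u ∈ revRow n (X₀ ∪ V₀)
    u∈X₀∪V₀ = ∈-revRow⁺ u-colₙ (∪⁺ʳ X₀ V₀ (∈-++⁺ʳ R (here refl)))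

    hs ls : List ℕ
    hs = proj₁ (∈-∃++ u∈X₀∪V₀)
    ls = proj₁ (proj₂ (∈-∃++ u∈X₀∪V₀))

    revRow-X₀∪V₀ : revRow n (X₀ ∪ V₀) ≡ hs ++ u ∷ ls
    revRow-X₀∪V₀ = proj₂ (proj₂ (∈-∃++ u∈X₀∪V₀))

    X₀∪V₀↓ : Decreasing (hs ++ u ∷ ls)
    X₀∪V₀↓ = subst Decreasing revRow-X₀∪V₀ (revRow-decreasing n (X₀ ∪ V₀))

    c<hs : All (c <_) hs
    c<hs = All.tabulate c<h
      where
      c<h : ∀ {h} → h ∈ hs → c < h
      c<h {h} h∈hs with u<h ← All.head (All.lookup (proj₂ (proj₂ (AllPairs-++⁻ hs X₀∪V₀↓))) h∈hs)
                   with col , h∈X₀∪V₀ ← ∈-revRow⁻ (subst (h ∈_) (sym revRow-X₀∪V₀) (∈-++⁺ˡ h∈hs))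
                   with ∪⁻ X₀ V₀ h∈X₀∪V₀
      ... | inj₁ X₀h = c<X₀ col X₀h
      ... | inj₂ h∈V₀ with V₀⊆u∷V h∈V₀
      ...   | inj₁ refl = contradiction u<h (<-irrefl refl)
      ...   | inj₂ h∈V with ∈-++⁻ R h∈V
      ...     | inj₁ h∈R    = c<R h∈R
      ...     | inj₂ h∈rest = contradiction u<h (<-asym (All.lookup u>rest h∈rest))

    revRow-X∪V : revRow n (X ∪ V) ≡ hs ++ c ∷ ls
    revRow-X∪V =
      revRow-replace hs ls revRow-X₀∪V₀ u≤c c<hs c-col (∪⁺ˡ X V Xc) X₀∪V₀⇒X∪V X∪V⇒X₀∪V₀
      where
      X₀∪V₀⇒X∪V : ∀ {j} → IsColumn n j → T ((X₀ ∪ V₀) j) → j ≢ u → T ((X ∪ V) j)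
      X₀∪V₀⇒X∪V _ h j≢u with ∪⁻ X₀ V₀ h
      ... | inj₁ X₀j  = ∪⁺ˡ X V (proj₁ (X₀⇒X X₀j))
      ... | inj₂ j∈V₀ = ∪⁺ʳ X V (Sum.fromInj₂ (λ j≡u → contradiction j≡u j≢u) (V₀⊆u∷V j∈V₀))
      X∪V⇒X₀∪V₀ : ∀ {j} → IsColumn n j → T ((X ∪ V) j) → j ≡ c ⊎ T ((X₀ ∪ V₀) j) × j ≢ u
      X∪V⇒X₀∪V₀ col h with ∪⁻ X V h
      ... | inj₂ j∈V = inj₂ (∪⁺ʳ X₀ V₀ (V⊆V₀ j∈V) , λ { refl → u∉V j∈V })
      ... | inj₁ Xj with X⇒X₀ Xj
      ...   | inj₁ j≡c = inj₁ j≡c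
      ...   | inj₂ X₀j =
        inj₂ (∪⁺ˡ X₀ V₀ X₀j , λ { refl → <-irrefl refl (<-≤-trans (c<X₀ col X₀j) u≤c) })

    invariant : MoveInvariant n Y X₀ V₀ → MoveInvariant n Y X V
    invariant ih = begin
      revRow n (Y ∖ V) ++ revRow n (X ∪ V)
        ≡⟨ cong₂ _++_ revRow-Y∖V revRow-X∪V ⟩
      revRow n (Y ∖ V₀) ∷ʳ u ++ hs ++ c ∷ ls
        ≡⟨ ∷ʳ-++ (revRow n (Y ∖ V₀)) u (hs ++ c ∷ ls) ⟩
      revRow n (Y ∖ V₀) ++ u ∷ hs ++ c ∷ ls
        ≈⟨ knuth-++ˡ (revRow n (Y ∖ V₀)) (column-bump hs X₀∪V₀↓ u≤c c<hs) ⟩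
      revRow n (Y ∖ V₀) ++ (hs ++ u ∷ ls) ∷ʳ c
        ≡⟨ ++-assoc (revRow n (Y ∖ V₀)) (hs ++ u ∷ ls) [ c ] ⟨
      (revRow n (Y ∖ V₀) ++ hs ++ u ∷ ls) ∷ʳ c
        ≡⟨ cong (λ r → (revRow n (Y ∖ V₀) ++ r) ∷ʳ c) revRow-X₀∪V₀ ⟨
      (revRow n (Y ∖ V₀) ++ revRow n (X₀ ∪ V₀)) ∷ʳ c
        ≈⟨ append-c ih ⟩
      revRow n Y ++ revRow n X ∎
      where open ≈-Reasoning

module LeftmostBallStack {n : ℕ} (Y X : ℕ → Bool) {b : ℕ} (c≤n : suc b ≤ n)
                         (none : NoneBelow (suc b) X) (Xc : T (X (suc b))) where

  c : ℕ
  c = suc b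

  open LeftmostBall Y X (s≤s z≤n , c≤n) Xc none

  X₀-none : NoneBelow (suc c) X₀
  X₀-none = noneBelow-suc (λ 1≤j j<c X₀j → none 1≤j j<c (proj₁ (X₀⇒X X₀j)))
                          (λ X₀c → proj₂ (X₀⇒X X₀c) refl)

  post : List ℕ
  post = proj₁ (cols-split (≤⇒≤′ c≤n))

  cols-n : cols n ≡ cols c ++ post
  cols-n = proj₁ (proj₂ (cols-split (≤⇒≤′ c≤n)))

  c<post : All (c <_) post
  c<post = proj₂ (proj₂ (cols-split (≤⇒≤′ c≤n)))

  stack : List ℕ
  stack = revRow c Y

  R : List ℕ
  R = unmatched X Y [] post

  p : ℕ
  p = surplusPops X Y post

  c<R : ∀ {j} → j ∈ R → c < j
  c<R j∈R with ∈-unmatched⁻ X Y [] post j∈R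
  ... | inj₂ j∈post = All.lookup c<post j∈post

  unmatched-X : unmatched X Y [] (cols n) ≡ R ++ drop 1 (drop p stack)
  unmatched-X = begin
    unmatched X Y [] (cols n)
      ≡⟨ cong (unmatched X Y []) cols-n ⟩
    unmatched X Y [] (cols c ++ post)
      ≡⟨ foldl-++ (matchColumn X Y) [] (cols c) post ⟩
    unmatched X Y (unmatched X Y [] (cols c)) post
      ≡⟨ cong (λ st → unmatched X Y st post) (unmatched-first-pop b Y none) ⟩
    unmatched X Y (popIf (X c) stack) post
      ≡⟨ cong (λ x → unmatched X Y (popIf x stack) post) (Equivalence.to T-≡ Xc) ⟩
    unmatched X Y (drop 1 stack) post
      ≡⟨ unmatched-from-stack X Y _ post ⟩
    R ++ drop p (drop 1 stack)
      ≡⟨ cong (R ++_) drop-p-drop-1 ⟩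
    R ++ drop 1 (drop p stack) ∎
    where
    open ≡-Reasoning
    drop-p-drop-1 : drop p (drop 1 stack) ≡ drop 1 (drop p stack)
    drop-p-drop-1 = trans (drop-drop 1 p stack)
                          (trans (cong (λ k → drop k stack) (+-comm 1 p)) (sym (drop-drop p 1 stack)))

  unmatched-X₀ : unmatched X₀ Y [] (cols n) ≡ R ++ drop p stack
  unmatched-X₀ = begin
    unmatched X₀ Y [] (cols n)
      ≡⟨ cong (unmatched X₀ Y []) cols-n ⟩
    unmatched X₀ Y [] (cols c ++ post)
      ≡⟨ foldl-++ (matchColumn X₀ Y) [] (cols c) post ⟩
    unmatched X₀ Y (unmatched X₀ Y [] (cols c)) post
      ≡⟨ cong (λ st → unmatched X₀ Y st post) (unmatched-noneBelow c Y X₀-none) ⟩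
    unmatched X₀ Y stack post
      ≡⟨ unmatched-cong Y stack X₀≡X ⟩
    unmatched X Y stack post
      ≡⟨ unmatched-from-stack X Y stack post ⟩
    R ++ drop p stack ∎
    where
    open ≡-Reasoning
    X₀≡X : All (λ j → X₀ j ≡ X j) post
    X₀≡X = All.map (λ c<j → ∖-∉ X [ c ] λ { (here refl) → <-irrefl refl c<j }) c<post

  -- X and X₀ differ only at column c, where X pops the top of the stack; on the
  -- remaining columns this extra pop survives exactly when drop p stack is nonempty.
  from-stack-top : ∀ top → drop p stack ≡ top →
                   MoveInvariant n Y X₀ (R ++ top) → MoveInvariant n Y X (R ++ drop 1 top)
  from-stack-top []         _  = invariant-unchanged c<R++[]
    where
    c<R++[] : ∀ {j} → j ∈ R ++ [] → c < j
    c<R++[] j∈ with ∈-++⁻ R j∈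
    ... | inj₁ j∈R = c<R j∈R
  from-stack-top (u ∷ rest) eq = Bumped.invariant R rest c<R u-col Yu u>rest Y-below-u
    where
    stack≡ : stack ≡ take p stack ++ u ∷ rest
    stack≡ = trans (sym (take++drop≡id p stack)) (cong (take p stack ++_) eq)
    stack↓ : Decreasing (take p stack ++ u ∷ rest)
    stack↓ = subst Decreasing stack≡ (revRow-decreasing c Y)
    u-in-stack : IsColumn c u × T (Y u)
    u-in-stack = ∈-revRow⁻ {P = Y} (subst (u ∈_) (sym stack≡) (∈-++⁺ʳ (take p stack) (here refl)))
    u-col : IsColumn c u
    u-col = proj₁ u-in-stack
    Yu : T (Y u)
    Yu = proj₂ u-in-stack
    u>rest : All (_< u) rest
    u>rest = AllPairs-head (proj₁ (proj₂ (AllPairs-++⁻ (take p stack) stack↓)))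
    Y-below-u : ∀ {j} → 1 ≤ j → j < u → T (Y j) → j ∈ rest
    Y-below-u 1≤j j<u Yj = ∈-below-pivot (take p stack) stack↓
      (subst (_ ∈_) stack≡ (∈-revRow⁺ {P = Y} (1≤j , ≤-trans (<⇒≤ j<u) (proj₂ u-col)) Yj)) j<u

  step : MoveInvariant n Y X₀ (unmatched X₀ Y [] (cols n)) → MoveInvariant n Y X (unmatched X Y [] (cols n))
  step ih = subst (MoveInvariant n Y X) (sym unmatched-X)
                  (from-stack-top (drop p stack) refl (subst (MoveInvariant n Y X₀) unmatched-X₀ ih))

moveUnmatched-base : ∀ n Y X → NoneBelow (suc n) X → MoveInvariant n Y X (unmatched X Y [] (cols n))
moveUnmatched-base n Y X none =
  subst (MoveInvariant n Y X) (sym (unmatched-noneBelow n Y none)) (knuth-reflexive (begin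
    revRow n (Y ∖ revRow n Y) ++ revRow n (X ∪ revRow n Y) ≡⟨ cong₂ _++_ revRow-Y∖Y revRow-X∪Y ⟩
    revRow n Y                                             ≡⟨ ++-identityʳ (revRow n Y) ⟨
    revRow n Y ++ []                                       ≡⟨ cong (revRow n Y ++_) revRow-X ⟨
    revRow n Y ++ revRow n X                               ∎))
  where
  open ≡-Reasoning
  ¬X : ∀ {j} → IsColumn n j → ¬ T (X j)
  ¬X (1≤j , j≤n) = none 1≤j (s≤s j≤n)
  revRow-Y∖Y : revRow n (Y ∖ revRow n Y) ≡ []
  revRow-Y∖Y = revRow-≡ {n} {Y ∖ revRow n Y} [] (λ ())
    λ col h → let Yj , j∉ = ∖⁻ Y _ h in contradiction (∈-revRow⁺ {P = Y} col Yj) j∉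
  revRow-X∪Y : revRow n (X ∪ revRow n Y) ≡ revRow n Y
  revRow-X∪Y = revRow-≡ {n} {X ∪ revRow n Y} (revRow-decreasing n Y)
    (λ j∈ → proj₁ (∈-revRow⁻ j∈) , ∪⁺ʳ X _ j∈)
    λ col h → Sum.fromInj₂ (λ Xj → contradiction Xj (¬X col)) (∪⁻ X _ h)
  revRow-X : revRow n X ≡ []
  revRow-X = revRow-≡ {n} {X} [] (λ ()) λ col Xj → contradiction Xj (¬X col)

moveUnmatched-from : ∀ k b {n} → k + b ≡ n → ∀ Y X → NoneBelow (suc b) X →
                     MoveInvariant n Y X (unmatched X Y [] (cols n))
moveUnmatched-from zero    b refl Y X none = moveUnmatched-base b Y X none
moveUnmatched-from (suc k) b refl Y X none with T? (X (suc b))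
... | yes Xc = LeftmostBallStack.step Y X c≤n none Xc
                 (moveUnmatched-from k (suc b) (+-suc k b) Y _ (LeftmostBallStack.X₀-none Y X c≤n none Xc))
  where
  c≤n : suc b ≤ suc (k + b)
  c≤n = s≤s (m≤n+m b k)
... | no ¬Xc = moveUnmatched-from k (suc b) (+-suc k b) Y X (noneBelow-suc none ¬Xc)

moveUnmatched-knuth : ∀ n Y X → MoveInvariant n Y X (unmatched X Y [] (cols n))
moveUnmatched-knuth n Y X = moveUnmatched-from n 0 (+-identityʳ n) Y X λ { (s≤s z≤n) (s≤s ()) }

-- Ball configurations

≡ᵇ-refl : ∀ m → (m ≡ᵇ m) ≡ true
≡ᵇ-refl m = Equivalence.to T-≡ (≡⇒≡ᵇ m m refl)

≡ᵇ-≢ : ∀ {m n} → m ≢ n → (m ≡ᵇ n) ≡ false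
≡ᵇ-≢ {m} {n} m≢n with m ≡ᵇ n in e
... | true  = contradiction (≡ᵇ⇒≡ m n (subst T (sym e) _)) m≢n
... | false = refl

indexedFrom : ℕ → Config → List (ℕ × (ℕ → Bool))
indexedFrom k []      = []
indexedFrom k (r ∷ B) = (k , r) ∷ indexedFrom (suc k) B

zip-applyUpTo : ∀ f k B → (∀ m → f m ≡ k + m) → zip (applyUpTo f (length B)) B ≡ indexedFrom k B
zip-applyUpTo f k []      _    = refl
zip-applyUpTo f k (r ∷ B) f≗k+ =
  cong₂ (λ r′ rest → (r′ , r) ∷ rest) (trans (f≗k+ 0) (+-identityʳ k))
        (zip-applyUpTo (f ∘ suc) (suc k) B λ m → trans (f≗k+ (suc m)) (+-suc k m))

indexed≡indexedFrom : ∀ B → indexed B ≡ indexedFrom 1 B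
indexed≡indexedFrom B = zip-applyUpTo suc 1 B λ _ → refl

indexedFrom-++ : ∀ k A C → indexedFrom k (A ++ C) ≡ indexedFrom k A ++ indexedFrom (k + length A) C
indexedFrom-++ k []      C = cong (λ k′ → indexedFrom k′ C) (sym (+-identityʳ k))
indexedFrom-++ k (r ∷ A) C =
  cong ((k , r) ∷_) (trans (indexedFrom-++ (suc k) A C)
                           (cong (λ k′ → indexedFrom (suc k) A ++ indexedFrom k′ C) (sym (+-suc k (length A)))))

indexedFrom-bounds : ∀ k C → All (λ e → k ≤ proj₁ e × proj₁ e < k + length C) (indexedFrom k C)
indexedFrom-bounds k []      = []
indexedFrom-bounds k (r ∷ C) =
  (≤-refl , subst (k <_) (sym (+-suc k (length C))) (s≤s (m≤m+n k (length C)))) ∷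
  All.map (λ {e} (k<r , r<) → <⇒≤ k<r , subst (proj₁ e <_) (sym (+-suc k (length C))) r<)
          (indexedFrom-bounds (suc k) C)

map-proj₂-indexedFrom : ∀ k C → map proj₂ (indexedFrom k C) ≡ C
map-proj₂-indexedFrom k []      = refl
map-proj₂-indexedFrom k (r ∷ C) = cong (r ∷_) (map-proj₂-indexedFrom (suc k) C)

-- Named copies of the local functions of cwBalls and eStar in Defs.
ballsAt : ℕ → ℕ × (ℕ → Bool) → List (ℕ × ℕ)
ballsAt j (r , row) = if row j then (r , j) ∷ [] else []

columnBalls : Config → ℕ → List (ℕ × ℕ)
columnBalls B j = concatMap (ballsAt j) (reverse (indexed B))

moveBalls : ℕ → List ℕ → ℕ × (ℕ → Bool) → (ℕ → Bool)
moveBalls i U (r , row) = if r ≡ᵇ suc i then row ∖ U else if r ≡ᵇ i then row ∪ U else row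

eStar≡map : ∀ n i B → eStar n i B ≡ map (moveBalls i (unmatchedAbove n i B)) (indexed B)
eStar≡map n i B = refl

ballStep : ℕ → List ℕ → ℕ × ℕ → List ℕ
ballStep i st (r , c) = if r ≡ᵇ suc i then c ∷ st else if r ≡ᵇ i then drop 1 st else st

unmatchedGo≡foldl : ∀ i st es → unmatchedGo i st es ≡ foldl (ballStep i) st es
unmatchedGo≡foldl i st []             = refl
unmatchedGo≡foldl i st ((r , c) ∷ es) with r ≡ᵇ suc i
... | true  = unmatchedGo≡foldl i (c ∷ st) es
... | false with r ≡ᵇ i | st
...   | false | st′     = unmatchedGo≡foldl i st′ es
...   | true  | []      = unmatchedGo≡foldl i [] es
...   | true  | _ ∷ st′ = unmatchedGo≡foldl i st′ es

unmatchedAbove≡foldl : ∀ n i B → unmatchedAbove n i B ≡ foldl (ballStep i) [] (concatMap (columnBalls B) (cols n))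
unmatchedAbove≡foldl n i B = unmatchedGo≡foldl i [] (cwBalls n B)

entryStep : ℕ → ℕ → List ℕ → ℕ × (ℕ → Bool) → List ℕ
entryStep i j st e = foldl (ballStep i) st (ballsAt j e)

entryStep-skip : ∀ i j st {r} row → r ≢ suc i → r ≢ i → entryStep i j st (r , row) ≡ st
entryStep-skip i j st row r≢1+i r≢i with row j
... | false = refl
... | true rewrite ≡ᵇ-≢ r≢1+i | ≡ᵇ-≢ r≢i = refl

entryStep-above : ∀ i j st (Y : ℕ → Bool) → entryStep i j st (suc i , Y) ≡ pushIf (Y j) j st
entryStep-above i j st Y with Y j
... | false = refl
... | true rewrite ≡ᵇ-refl i = refl

entryStep-below : ∀ i j st (X : ℕ → Bool) → entryStep i j st (i , X) ≡ popIf (X j) st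
entryStep-below i j st X with X j
... | false = refl
... | true rewrite ≡ᵇ-≢ {i} {suc i} (1+n≢n ∘ sym) | ≡ᵇ-refl i = refl

rw-++ : ∀ n A C → rw n (A ++ C) ≡ rw n A ++ rw n C
rw-++ n = concatMap-++ (λ row → filterᵇ row (cols n))

reverse-rw-pair : ∀ n B₁ X Y B₂ →
  reverse (rw n (B₁ ++ X ∷ Y ∷ B₂)) ≡ reverse (rw n B₂) ++ (revRow n Y ++ revRow n X) ++ reverse (rw n B₁)
reverse-rw-pair n B₁ X Y B₂ = begin
  reverse (rw n (B₁ ++ X ∷ Y ∷ B₂))
    ≡⟨ cong reverse (rw-++ n B₁ (X ∷ Y ∷ B₂)) ⟩
  reverse (rw n B₁ ++ rowX ++ rowY ++ rw n B₂)
    ≡⟨ reverse-++ (rw n B₁) _ ⟩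
  reverse (rowX ++ rowY ++ rw n B₂) ++ reverse (rw n B₁)
    ≡⟨ cong (_++ reverse (rw n B₁)) (reverse-++ rowX _) ⟩
  (reverse (rowY ++ rw n B₂) ++ reverse rowX) ++ reverse (rw n B₁)
    ≡⟨ cong (λ w → (w ++ reverse rowX) ++ reverse (rw n B₁)) (reverse-++ rowY (rw n B₂)) ⟩
  ((reverse (rw n B₂) ++ reverse rowY) ++ reverse rowX) ++ reverse (rw n B₁)
    ≡⟨ cong (_++ reverse (rw n B₁)) (++-assoc (reverse (rw n B₂)) _ _) ⟩
  (reverse (rw n B₂) ++ reverse rowY ++ reverse rowX) ++ reverse (rw n B₁)
    ≡⟨ ++-assoc (reverse (rw n B₂)) _ _ ⟩
  reverse (rw n B₂) ++ (reverse rowY ++ reverse rowX) ++ reverse (rw n B₁)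
    ≡⟨ cong (λ w → reverse (rw n B₂) ++ w ++ reverse (rw n B₁))
            (cong₂ _++_ (reverse-rowWord n Y) (reverse-rowWord n X)) ⟩
  reverse (rw n B₂) ++ (revRow n Y ++ revRow n X) ++ reverse (rw n B₁) ∎
  where
  open ≡-Reasoning
  rowX rowY : Word
  rowX = filterᵇ X (cols n)
  rowY = filterᵇ Y (cols n)

module AdjacentRows (n : ℕ) (B₁ : Config) (X Y : ℕ → Bool) (B₂ : Config) where

  i : ℕ
  i = suc (length B₁)

  B : Config
  B = B₁ ++ X ∷ Y ∷ B₂

  Below Above : List (ℕ × (ℕ → Bool))
  Below = indexedFrom 1 B₁
  Above = indexedFrom (suc (suc i)) B₂

  indexed-B : indexed B ≡ Below ++ (i , X) ∷ (suc i , Y) ∷ Above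
  indexed-B = trans (indexed≡indexedFrom B) (indexedFrom-++ 1 B₁ (X ∷ Y ∷ B₂))

  Elsewhere : ℕ × (ℕ → Bool) → Set
  Elsewhere e = proj₁ e ≢ suc i × proj₁ e ≢ i

  below-elsewhere : All Elsewhere Below
  below-elsewhere = All.map (λ (_ , r<i) → (λ { refl → <-irrefl refl (<-trans r<i (n<1+n i)) })
                                          , (λ { refl → <-irrefl refl r<i }))
                            (indexedFrom-bounds 1 B₁)

  above-elsewhere : All Elsewhere Above
  above-elsewhere = All.map (λ (2+i≤r , _) → (λ { refl → <-irrefl refl 2+i≤r })
                                              , (λ { refl → <-irrefl refl (<-trans (n<1+n i) 2+i≤r) }))
                            (indexedFrom-bounds (suc (suc i)) B₂)

  column : ∀ st j → foldl (ballStep i) st (columnBalls B j) ≡ matchColumn X Y st j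
  column st j = begin
    foldl (ballStep i) st (columnBalls B j)
      ≡⟨ foldl-concatMap (ballStep i) (ballsAt j) (λ _ _ → refl) st (reverse (indexed B)) ⟩
    step st (reverse (indexed B))
      ≡⟨ cong (step st ∘ reverse) indexed-B ⟩
    step st (reverse (Below ++ (i , X) ∷ (suc i , Y) ∷ Above))
      ≡⟨ cong (step st) (reverse-++-∷-∷ Below Above) ⟩
    step st (reverse Above ++ (suc i , Y) ∷ (i , X) ∷ reverse Below)
      ≡⟨ foldl-++ (entryStep i j) st (reverse Above) _ ⟩
    step (step st (reverse Above)) ((suc i , Y) ∷ (i , X) ∷ reverse Below)
      ≡⟨ cong (λ st′ → step st′ ((suc i , Y) ∷ (i , X) ∷ reverse Below))
              (step-elsewhere st (All-reverse⁺ above-elsewhere)) ⟩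
    step (entryStep i j (entryStep i j st (suc i , Y)) (i , X)) (reverse Below)
      ≡⟨ step-elsewhere _ (All-reverse⁺ below-elsewhere) ⟩
    entryStep i j (entryStep i j st (suc i , Y)) (i , X)
      ≡⟨ entryStep-below i j _ X ⟩
    popIf (X j) (entryStep i j st (suc i , Y))
      ≡⟨ cong (popIf (X j)) (entryStep-above i j st Y) ⟩
    matchColumn X Y st j ∎
    where
    open ≡-Reasoning
    step : List ℕ → List (ℕ × (ℕ → Bool)) → List ℕ
    step = foldl (entryStep i j)
    step-elsewhere : ∀ st {es} → All Elsewhere es → step st es ≡ st
    step-elsewhere st []                                             = refl
    step-elsewhere st {(_ , row) ∷ es} ((r≢1+i , r≢i) ∷ elsewhere) =
      trans (cong (λ st′ → step st′ es) (entryStep-skip i j st row r≢1+i r≢i)) (step-elsewhere st elsewhere)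

  U : List ℕ
  U = unmatchedAbove n i B

  U≡unmatched : U ≡ unmatched X Y [] (cols n)
  U≡unmatched = trans (unmatchedAbove≡foldl n i B) (foldl-concatMap (ballStep i) (columnBalls B) column [] (cols n))

  eStar-B : eStar n i B ≡ B₁ ++ (X ∪ U) ∷ (Y ∖ U) ∷ B₂
  eStar-B = begin
    eStar n i B
      ≡⟨ eStar≡map n i B ⟩
    map (moveBalls i U) (indexed B)
      ≡⟨ cong (map (moveBalls i U)) indexed-B ⟩
    map (moveBalls i U) (Below ++ (i , X) ∷ (suc i , Y) ∷ Above)
      ≡⟨ map-++ (moveBalls i U) Below _ ⟩
    map (moveBalls i U) Below ++ moveBalls i U (i , X) ∷ moveBalls i U (suc i , Y) ∷ map (moveBalls i U) Above
      ≡⟨ cong₂ _++_ (unchanged 1 B₁ below-elsewhere)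
                    (cong₂ _∷_ move-X (cong₂ _∷_ move-Y (unchanged _ B₂ above-elsewhere))) ⟩
    B₁ ++ (X ∪ U) ∷ (Y ∖ U) ∷ B₂ ∎
    where
    open ≡-Reasoning
    unchanged : ∀ k C → All Elsewhere (indexedFrom k C) → map (moveBalls i U) (indexedFrom k C) ≡ C
    unchanged k C elsewhere =
      trans (map-cong-local (All.map (λ { {_ , _} (r≢1+i , r≢i) → stay r≢1+i r≢i }) elsewhere))
            (map-proj₂-indexedFrom k C)
      where
      stay : ∀ {r row} → r ≢ suc i → r ≢ i → moveBalls i U (r , row) ≡ row
      stay r≢1+i r≢i rewrite ≡ᵇ-≢ r≢1+i | ≡ᵇ-≢ r≢i = refl
    move-X : moveBalls i U (i , X) ≡ X ∪ U
    move-X rewrite ≡ᵇ-≢ {i} {suc i} (1+n≢n ∘ sym) | ≡ᵇ-refl i = refl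
    move-Y : moveBalls i U (suc i , Y) ≡ Y ∖ U
    move-Y rewrite ≡ᵇ-refl i = refl

  eStar-knuth : KnuthEquiv (reverse (rw n (eStar n i B))) (reverse (rw n B))
  eStar-knuth = begin
    reverse (rw n (eStar n i B))
      ≡⟨ cong (reverse ∘ rw n) eStar-B ⟩
    reverse (rw n (B₁ ++ (X ∪ U) ∷ (Y ∖ U) ∷ B₂))
      ≡⟨ reverse-rw-pair n B₁ _ _ B₂ ⟩
    reverse (rw n B₂) ++ (revRow n (Y ∖ U) ++ revRow n (X ∪ U)) ++ reverse (rw n B₁)
      ≈⟨ knuth-++ˡ (reverse (rw n B₂)) (knuth-++ʳ (reverse (rw n B₁)) two-rows) ⟩
    reverse (rw n B₂) ++ (revRow n Y ++ revRow n X) ++ reverse (rw n B₁)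
      ≡⟨ reverse-rw-pair n B₁ X Y B₂ ⟨
    reverse (rw n B) ∎
    where
    open ≈-Reasoning
    two-rows : MoveInvariant n Y X U
    two-rows = subst (MoveInvariant n Y X) (sym U≡unmatched) (moveUnmatched-knuth n Y X)

splitRows : ∀ k (B : Config) → suc (suc k) ≤ length B →
            ∃[ B₁ ] ∃[ X ] ∃[ Y ] ∃[ B₂ ] B ≡ B₁ ++ X ∷ Y ∷ B₂ × length B₁ ≡ k
splitRows zero    (X ∷ Y ∷ B₂) _       = [] , X , Y , B₂ , refl , refl
splitRows zero    (_ ∷ [])     (s≤s ())
splitRows (suc k) (r ∷ B)      (s≤s h) with B₁ , X , Y , B₂ , refl , refl ← splitRows k B h =
  r ∷ B₁ , X , Y , B₂ , refl , refl

eStar-knuth : ∀ n i B → 1 ≤ i → i < length B → KnuthEquiv (reverse (rw n (eStar n i B))) (reverse (rw n B))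
eStar-knuth n (suc k) B _ i<len with splitRows k B i<len
... | B₁ , X , Y , B₂ , refl , refl = AdjacentRows.eStar-knuth n B₁ X Y B₂

length-eStar : ∀ n i B → length (eStar n i B) ≡ length B
length-eStar n i B = begin
  length (eStar n i B)                         ≡⟨ length-map _ (indexed B) ⟩
  length (indexed B)                           ≡⟨ length-zipWith _,_ (applyUpTo suc (length B)) B ⟩
  length (applyUpTo suc (length B)) ⊓ length B ≡⟨ cong (_⊓ length B) (length-applyUpTo suc (length B)) ⟩
  length B ⊓ length B                          ≡⟨ ⊓-idem (length B) ⟩
  length B                                     ∎
  where open ≡-Reasoning

length-eStarTo : ∀ n b B → length (eStarTo n b B) ≡ length B
length-eStarTo n zero    B = refl
length-eStarTo n (suc b) B = trans (length-eStarTo n b _) (length-eStar n (suc b) B)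

length-rhoSteps : ∀ n m B → length (rhoSteps n m B) ≡ length B
length-rhoSteps n zero    B = refl
length-rhoSteps n (suc m) B = trans (length-eStarTo n (suc m) _) (length-rhoSteps n m B)

eStarTo-knuth : ∀ n b B → b < length B → KnuthEquiv (reverse (rw n (eStarTo n b B))) (reverse (rw n B))
eStarTo-knuth n zero    B _       = knuth-refl
eStarTo-knuth n (suc b) B b+1<len = knuth-trans
  (eStarTo-knuth n b (eStar n (suc b) B) (subst (b <_) (sym (length-eStar n (suc b) B)) (<-trans (n<1+n b) b+1<len)))
  (eStar-knuth n (suc b) B (s≤s z≤n) b+1<len)

rhoSteps-knuth : ∀ n m B → m < length B → KnuthEquiv (reverse (rw n (rhoSteps n m B))) (reverse (rw n B))
rhoSteps-knuth n zero    B _       = knuth-refl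
rhoSteps-knuth n (suc m) B m+1<len = knuth-trans
  (eStarTo-knuth n (suc m) (rhoSteps n m B) (subst (suc m <_) (sym (length-rhoSteps n m B)) m+1<len))
  (rhoSteps-knuth n m B (<-trans (n<1+n m) m+1<len))

rhoN-knuth : ∀ n B → KnuthEquiv (reverse (rw n (rhoN n B))) (reverse (rw n B))
rhoN-knuth n []      = knuth-refl
rhoN-knuth n (r ∷ B) = rhoSteps-knuth n (length B) (r ∷ B) (n<1+n (length B))

filter-cols-≡ᵇ : ∀ {n a} → IsColumn n a → filterᵇ (_≡ᵇ a) (cols n) ≡ [ a ]
filter-cols-≡ᵇ {n} {a} a-col = begin
  filterᵇ (_≡ᵇ a) (cols n)                     ≡⟨ reverse-involutive _ ⟨
  reverse (reverse (filterᵇ (_≡ᵇ a) (cols n))) ≡⟨ cong reverse (trans (reverse-rowWord n (_≡ᵇ a)) revRow-a) ⟩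
  [ a ]                                        ∎
  where
  open ≡-Reasoning
  revRow-a : revRow n (_≡ᵇ a) ≡ [ a ]
  revRow-a = revRow-≡ {n} {_≡ᵇ a} ([] ∷ []) (λ { (here refl) → a-col , ≡⇒≡ᵇ a a refl })
                                         (λ _ j≡ᵇa → here (≡ᵇ⇒≡ _ a j≡ᵇa))

rw-singletonRows : ∀ n w → All (IsColumn n) w → rw n (singletonRows w) ≡ w
rw-singletonRows n []      []               = refl
rw-singletonRows n (a ∷ w) (a-col ∷ w-cols) = cong₂ _++_ (filter-cols-≡ᵇ a-col) (rw-singletonRows n w w-cols)

lemmaA7 : (n : ℕ) (w : List ℕ) → All (λ a → 1 ≤ a × a ≤ n) w →
    KnuthEquiv (reverse (rw n (rho n w))) (reverse w)
lemmaA7 n w w-cols = knuth-trans (rhoN-knuth n (singletonRows w))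
                                 (knuth-reflexive (cong reverse (rw-singletonRows n w w-cols)))
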